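{- (Strong Normalization.) Let beta-reduction on proof terms be the congruence closure of $(\lambda a.p)\ p'\to_\beta[p'/a]p$. If $e:F$ is derivable (given some logic program $\Phi$), then $e$ is strongly normalizing with respect to beta-reduction.
   Context: First-order terms $t ::= x \mid f(t_1,\dots,t_n)$; atomic formulas $P(t_1,\dots,t_n)$; Horn formulas $F ::= [\forall \underline{x}].\ A_1,\dots,A_n \Rightarrow A$ ($n\ge0$), where $\forall\underline{x}.F$ quantifies all free term variables of $F$ and $[\forall\underline{x}].F$ means $F$ or $\forall\underline{x}.F$. Proof terms $p,e ::= \kappa \mid a \mid \lambda a.e \mid e\ e'$ ($\kappa$ proof-term constants, $a$ proof-term variables). A logic program $\Phi$ is a list of closed Horn formulas labelled by distinct proof-term constants $\kappa$. Typing $e:F$ given $\Phi$ is generated by: (axiom) $\kappa:\forall\underline{x}.F$ if $(\kappa:\forall\underline{x}.F)\in\Phi$; (gen) from $e:F$ infer $e:\forall\underline{x}.F$; (inst) from $e:\forall\underline{x}.F$ infer $e:[\underline{t}/\underline{x}]F$; (cut) from $e_1:\underline{A}\Rightarrow D$ and $e_2:\underline{B},D\Rightarrow C$ infer $\lambda\underline{a}.\lambda\underline{b}.(e_2\ \underline{b})\ (e_1\ \underline{a}) : \underline{A},\underline{B}\Rightarrow C$, where $\underline{a},\underline{b}$ are lists of proof-term variables of the lengths of $\underline{A},\underline{B}$ not free in $e_1,e_2$, $\lambda\underline{a}.t=\lambda a_1.\cdots\lambda a_n.t$ and $t\ \underline{b}=(\dots(t\ b_1)\dots b_n)$. -}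

module Defs where

open import Data.Nat using (ℕ; zero; suc; _+_)
open import Data.List using (List; []; _∷_; _++_; [_]; length; map)
open import Data.Vec using (Vec; []; _∷_)
open import Data.Product using (_×_; _,_)
open import Data.List.Membership.Propositional using (_∈_)
open import Induction.WellFounded using (Acc)

-- Proof terms  p, e ::= κ | a | λa.e | e e'
-- Proof-term variables are de Bruijn indices (terms up to α-equivalence);
-- proof-term constants κ are named by natural numbers.

data PTerm : Set where
  con : ℕ → PTerm
  var : ℕ → PTerm
  lam : PTerm → PTerm
  _·_ : PTerm → PTerm → PTerm

infixl 7 _·_

ext : (ℕ → ℕ) → ℕ → ℕ
ext ρ zero    = zero
ext ρ (suc n) = suc (ρ n)

rename : (ℕ → ℕ) → PTerm → PTerm
rename ρ (con k) = con k
rename ρ (var n) = var (ρ n)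
rename ρ (lam t) = lam (rename (ext ρ) t)
rename ρ (t · u) = rename ρ t · rename ρ u

exts : (ℕ → PTerm) → ℕ → PTerm
exts σ zero    = var zero
exts σ (suc n) = rename suc (σ n)

subst : (ℕ → PTerm) → PTerm → PTerm
subst σ (con k) = con k
subst σ (var n) = σ n
subst σ (lam t) = lam (subst (exts σ) t)
subst σ (t · u) = subst σ t · subst σ u

-- [p'/a]p : substitute for the outermost bound variable (index 0)
single : PTerm → ℕ → PTerm
single u zero    = u
single u (suc n) = var n

_[_≔0] : PTerm → PTerm → PTerm
t [ u ≔0] = subst (single u) t

infix 4 _⟶β_
data _⟶β_ : PTerm → PTerm → Set where
  β     : ∀ {t u} → (lam t · u) ⟶β (t [ u ≔0])
  ξ-lam : ∀ {t t'} → t ⟶β t' → lam t ⟶β lam t'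
  ξ-appˡ : ∀ {t t' u} → t ⟶β t' → (t · u) ⟶β (t' · u)
  ξ-appʳ : ∀ {t u u'} → u ⟶β u' → (t · u) ⟶β (t · u')

SN : PTerm → Set
SN = Acc (λ e' e → e ⟶β e')

shift : ℕ → PTerm → PTerm
shift k = rename (k +_)

lams : ℕ → PTerm → PTerm
lams zero    t = t
lams (suc k) t = lam (lams k t)

-- appsDesc t b k = t (var (b+k-1)) ... (var b)
appsDesc : PTerm → ℕ → ℕ → PTerm
appsDesc t b zero    = t
appsDesc t b (suc k) = appsDesc (t · var (b + k)) b k

module Logic (Fun : Set) (farity : Fun → ℕ) (Pred : Set) (parity : Pred → ℕ) where

  data Term : Set where
    tvar : ℕ → Term
    fn   : (f : Fun) → Vec Term (farity f) → Term

  data Atom : Set where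
    atom : (P : Pred) → Vec Term (parity P) → Atom

  mutual
    substT : (ℕ → Term) → Term → Term
    substT σ (tvar x) = σ x
    substT σ (fn f ts) = fn f (substTs σ ts)

    substTs : ∀ {n} → (ℕ → Term) → Vec Term n → Vec Term n
    substTs σ []       = []
    substTs σ (t ∷ ts) = substT σ t ∷ substTs σ ts

  substA : (ℕ → Term) → Atom → Atom
  substA σ (atom P ts) = atom P (substTs σ ts)

  record Horn : Set where
    constructor _⇒_
    field
      body : List Atom
      head : Atom

  substH : (ℕ → Term) → Horn → Horn
  substH σ (As ⇒ A) = map (substA σ) As ⇒ substA σ A

  -- [∀x̲].(A₁,…,Aₙ ⇒ A): ∀ binds all free term variables
  data Formula : Set where
    plain : Horn → Formula
    all   : Horn → Formula

  -- a logic program: closed Horn formulas ∀x̲.H labelled by constants κ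
  -- (the label list is required to be duplicate-free in the theorem)
  Program : Set
  Program = List (ℕ × Horn)

  infix 3 _⊢_∶_
  data _⊢_∶_ (Φ : Program) : PTerm → Formula → Set where
    axiom : ∀ {κ H} → (κ , H) ∈ Φ → Φ ⊢ con κ ∶ all H
    gen   : ∀ {e H} → Φ ⊢ e ∶ plain H → Φ ⊢ e ∶ all H
    inst  : ∀ {e H} (σ : ℕ → Term) → Φ ⊢ e ∶ all H → Φ ⊢ e ∶ plain (substH σ H)
    cut   : ∀ {e₁ e₂ As Bs D C} →
            Φ ⊢ e₁ ∶ plain (As ⇒ D) →
            Φ ⊢ e₂ ∶ plain ((Bs ++ [ D ]) ⇒ C) →
            Φ ⊢ lams (length As) (lams (length Bs)
                  (appsDesc (shift (length As + length Bs) e₂) 0 (length Bs)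
                   · appsDesc (shift (length As + length Bs) e₁) (length Bs) (length As)))
              ∶ plain ((As ++ Bs) ⇒ C)

-- Every derivable proof term is reducible: applied to SN arguments under an SN
-- substitution it is SN, where the number of arguments is the length of the body
-- of its Horn formula.  Constants are reducible because they head neutral terms,
-- and the term built by the cut rule is a block of λs whose body applies e₂ to
-- e₁; reducts of a head redex are controlled by weak head expansion, so the body
-- under the argument substitution inherits SN from the reducibility of e₁ and e₂.
-- Instantiating with variables then gives SN of the term itself.
module Submission where

open import Defs
open import Data.Nat using (ℕ; zero; suc; _+_)
open import Data.Nat.Properties using (+-suc; +-comm; +-identityʳ; suc-injective)
open import Data.List using (List; []; _∷_; _++_; [_]; _∷ʳ_; length; map; replicate; initLast; _∷ʳ′_)
open import Data.List.Properties using (length-++; length-++-comm; length-map; length-replicate)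
open import Data.List.Relation.Unary.All using (All; []; _∷_)
open import Data.List.Relation.Unary.All.Properties using (++⁻; ∷ʳ⁻; replicate⁺)
open import Data.List.Relation.Unary.Unique.Propositional using (Unique)
open import Data.Product using (proj₁; _×_; _,_; ∃₂)
open import Data.Empty using (⊥-elim)
open import Function using (_∘_)
open import Relation.Nullary using (¬_)
open import Relation.Binary.PropositionalEquality
  using (_≡_; _≗_; refl; sym; trans; cong; cong₂)
  renaming (subst to transport)
open import Relation.Binary.Construct.Closure.ReflexiveTransitive using (Star; ε; _◅_; _◅◅_; gmap)
open import Induction.WellFounded using (acc; acc-inverse)

ext-cong : ∀ {ρ ρ'} → ρ ≗ ρ' → ext ρ ≗ ext ρ'
ext-cong h zero    = refl
ext-cong h (suc i) = cong suc (h i)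

rename-cong : ∀ {ρ ρ'} → ρ ≗ ρ' → rename ρ ≗ rename ρ'
rename-cong h (con k) = refl
rename-cong h (var n) = cong var (h n)
rename-cong h (lam t) = cong lam (rename-cong (ext-cong h) t)
rename-cong h (t · u) = cong₂ _·_ (rename-cong h t) (rename-cong h u)

exts-cong : ∀ {σ σ'} → σ ≗ σ' → exts σ ≗ exts σ'
exts-cong h zero    = refl
exts-cong h (suc i) = cong (rename suc) (h i)

subst-cong : ∀ {σ σ'} → σ ≗ σ' → subst σ ≗ subst σ'
subst-cong h (con k) = refl
subst-cong h (var n) = h n
subst-cong h (lam t) = cong lam (subst-cong (exts-cong h) t)
subst-cong h (t · u) = cong₂ _·_ (subst-cong h t) (subst-cong h u)

rename-rename : ∀ ρ ρ' t → rename ρ (rename ρ' t) ≡ rename (ρ ∘ ρ') t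
rename-rename ρ ρ' (con k) = refl
rename-rename ρ ρ' (var n) = refl
rename-rename ρ ρ' (lam t) = cong lam (trans (rename-rename (ext ρ) (ext ρ') t)
  (rename-cong (λ { zero → refl ; (suc n) → refl }) t))
rename-rename ρ ρ' (t · u) = cong₂ _·_ (rename-rename ρ ρ' t) (rename-rename ρ ρ' u)

subst-rename : ∀ σ ρ t → subst σ (rename ρ t) ≡ subst (σ ∘ ρ) t
subst-rename σ ρ (con k) = refl
subst-rename σ ρ (var n) = refl
subst-rename σ ρ (lam t) = cong lam (trans (subst-rename (exts σ) (ext ρ) t)
  (subst-cong (λ { zero → refl ; (suc n) → refl }) t))
subst-rename σ ρ (t · u) = cong₂ _·_ (subst-rename σ ρ t) (subst-rename σ ρ u)

rename-subst : ∀ ρ σ t → rename ρ (subst σ t) ≡ subst (rename ρ ∘ σ) t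
rename-subst ρ σ (con k) = refl
rename-subst ρ σ (var n) = refl
rename-subst ρ σ (lam t) = cong lam (trans (rename-subst (ext ρ) (exts σ) t) (subst-cong exts-rename t))
  where
  exts-rename : rename (ext ρ) ∘ exts σ ≗ exts (rename ρ ∘ σ)
  exts-rename zero    = refl
  exts-rename (suc n) = trans (rename-rename (ext ρ) suc (σ n)) (sym (rename-rename suc ρ (σ n)))
rename-subst ρ σ (t · u) = cong₂ _·_ (rename-subst ρ σ t) (rename-subst ρ σ u)

subst-subst : ∀ σ τ t → subst σ (subst τ t) ≡ subst (subst σ ∘ τ) t
subst-subst σ τ (con k) = refl
subst-subst σ τ (var n) = refl
subst-subst σ τ (lam t) = cong lam (trans (subst-subst (exts σ) (exts τ) t) (subst-cong exts-subst t))
  where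
  exts-subst : subst (exts σ) ∘ exts τ ≗ exts (subst σ ∘ τ)
  exts-subst zero    = refl
  exts-subst (suc n) = trans (subst-rename (exts σ) suc (τ n)) (sym (rename-subst suc σ (τ n)))
subst-subst σ τ (t · u) = cong₂ _·_ (subst-subst σ τ t) (subst-subst σ τ u)

subst-var : ∀ t → subst var t ≡ t
subst-var (con k) = refl
subst-var (var n) = refl
subst-var (lam t) = cong lam (trans (subst-cong (λ { zero → refl ; (suc n) → refl }) t) (subst-var t))
subst-var (t · u) = cong₂ _·_ (subst-var t) (subst-var u)

rename≗subst-var : ∀ ρ t → rename ρ t ≡ subst (var ∘ ρ) t
rename≗subst-var ρ (con k) = refl
rename≗subst-var ρ (var n) = refl
rename≗subst-var ρ (lam t) = cong lam (trans (rename≗subst-var (ext ρ) t)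
  (subst-cong (λ { zero → refl ; (suc n) → refl }) t))
rename≗subst-var ρ (t · u) = cong₂ _·_ (rename≗subst-var ρ t) (rename≗subst-var ρ u)

infixr 5 _∷ₛ_ _++ₛ_

_∷ₛ_ : PTerm → (ℕ → PTerm) → ℕ → PTerm
(u ∷ₛ σ) zero    = u
(u ∷ₛ σ) (suc i) = σ i

_++ₛ_ : List PTerm → (ℕ → PTerm) → ℕ → PTerm
[] ++ₛ σ       = σ
(v ∷ vs) ++ₛ σ = v ∷ₛ (vs ++ₛ σ)

++ₛ-++ : ∀ xs ys σ → (xs ++ ys) ++ₛ σ ≗ xs ++ₛ (ys ++ₛ σ)
++ₛ-++ []       ys σ i       = refl
++ₛ-++ (x ∷ xs) ys σ zero    = refl
++ₛ-++ (x ∷ xs) ys σ (suc i) = ++ₛ-++ xs ys σ i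

subst-exts-[≔0] : ∀ σ u t → (subst (exts σ) t) [ u ≔0] ≡ subst (u ∷ₛ σ) t
subst-exts-[≔0] σ u t = trans (subst-subst (single u) (exts σ) t) (subst-cong single-exts t)
  where
  single-exts : subst (single u) ∘ exts σ ≗ u ∷ₛ σ
  single-exts zero    = refl
  single-exts (suc n) = trans (subst-rename (single u) suc (σ n)) (subst-var (σ n))

subst-[≔0] : ∀ σ u t → subst σ (t [ u ≔0]) ≡ (subst (exts σ) t) [ subst σ u ≔0]
subst-[≔0] σ u t = trans (subst-subst σ (single u) t)
  (trans (subst-cong (λ { zero → refl ; (suc n) → refl }) t) (sym (subst-exts-[≔0] σ (subst σ u) t)))

subst-⟶β : ∀ σ {t t'} → t ⟶β t' → subst σ t ⟶β subst σ t'
subst-⟶β σ (β {t} {u}) = transport (lam (subst (exts σ) t) · subst σ u ⟶β_) (sym (subst-[≔0] σ u t)) β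
subst-⟶β σ (ξ-lam s)  = ξ-lam (subst-⟶β (exts σ) s)
subst-⟶β σ (ξ-appˡ s) = ξ-appˡ (subst-⟶β σ s)
subst-⟶β σ (ξ-appʳ s) = ξ-appʳ (subst-⟶β σ s)

rename-⟶β : ∀ ρ {t t'} → t ⟶β t' → rename ρ t ⟶β rename ρ t'
rename-⟶β ρ {t} {t'} s rewrite rename≗subst-var ρ t | rename≗subst-var ρ t' = subst-⟶β (var ∘ ρ) s

infix 4 _⟶β*_
_⟶β*_ : PTerm → PTerm → Set
_⟶β*_ = Star _⟶β_

subst-⟶β* : ∀ {σ σ'} → (∀ i → σ i ⟶β* σ' i) → ∀ t → subst σ t ⟶β* subst σ' t
subst-⟶β* h (con k) = ε
subst-⟶β* h (var n) = h n
subst-⟶β* {σ} {σ'} h (lam t) = gmap lam ξ-lam (subst-⟶β* exts-⟶β* t)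
  where
  exts-⟶β* : ∀ i → exts σ i ⟶β* exts σ' i
  exts-⟶β* zero    = ε
  exts-⟶β* (suc i) = gmap (rename suc) (rename-⟶β suc) (h i)
subst-⟶β* {σ} {σ'} h (t · u) =
  gmap (_· subst σ u) ξ-appˡ (subst-⟶β* h t) ◅◅ gmap (subst σ' t ·_) ξ-appʳ (subst-⟶β* h u)

sn-⟶β* : ∀ {t t'} → t ⟶β* t' → SN t → SN t'
sn-⟶β* ε        sn = sn
sn-⟶β* (s ◅ ss) sn = sn-⟶β* ss (acc-inverse sn s)

sn-var : ∀ {n} → SN (var n)
sn-var = acc λ ()

sn-appˡ : ∀ {t u} → SN (t · u) → SN t
sn-appˡ (acc r) = acc λ s → sn-appˡ (r (ξ-appˡ s))

-- apps t (vₙ ∷ … ∷ v₁ ∷ []) = t v₁ … vₙ: the head of the list is the last argument.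
apps : PTerm → List PTerm → PTerm
apps t []       = t
apps t (v ∷ vs) = apps t vs · v

apps-∷ʳ : ∀ t xs a → apps t (xs ∷ʳ a) ≡ apps (t · a) xs
apps-∷ʳ t []       a = refl
apps-∷ʳ t (x ∷ xs) a = cong (_· x) (apps-∷ʳ t xs a)

sn-appsˡ : ∀ {t} vs → SN (apps t vs) → SN t
sn-appsˡ []       sn = sn
sn-appsˡ (v ∷ vs) sn = sn-appsˡ vs (sn-appˡ sn)

apps-⟶β : ∀ {t t'} vs → t ⟶β t' → apps t vs ⟶β apps t' vs
apps-⟶β []       s = s
apps-⟶β (v ∷ vs) s = ξ-appˡ (apps-⟶β vs s)

apps-⟶β* : ∀ {t t'} vs → t ⟶β* t' → apps t vs ⟶β* apps t' vs
apps-⟶β* vs = gmap (λ t → apps t vs) (apps-⟶β vs)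

infix 4 _⟶βₗ_
data _⟶βₗ_ : List PTerm → List PTerm → Set where
  here  : ∀ {v v' vs} → v ⟶β v' → v ∷ vs ⟶βₗ v' ∷ vs
  there : ∀ {v vs vs'} → vs ⟶βₗ vs' → v ∷ vs ⟶βₗ v ∷ vs'

apps-⟶βₗ : ∀ {t vs vs'} → vs ⟶βₗ vs' → apps t vs ⟶β apps t vs'
apps-⟶βₗ (here s)  = ξ-appʳ s
apps-⟶βₗ (there s) = ξ-appˡ (apps-⟶βₗ s)

data Neutral : PTerm → Set where
  con : ∀ {k} → Neutral (con k)
  _·_ : ∀ {t} → Neutral t → ∀ u → Neutral (t · u)

¬Neutral-lam : ∀ {t} → ¬ Neutral (lam t)
¬Neutral-lam ()

Neutral-⟶β : ∀ {t t'} → Neutral t → t ⟶β t' → Neutral t'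
Neutral-⟶β (n · _) β          = ⊥-elim (¬Neutral-lam n)
Neutral-⟶β (n · u) (ξ-appˡ s) = Neutral-⟶β n s · u
Neutral-⟶β (n · _) (ξ-appʳ {u' = u'} s) = n · u'

sn-neutral-app : ∀ {t u} → Neutral t → SN t → SN u → SN (t · u)
sn-neutral-app n (acc rt) (acc ru) = acc λ
  { β          → ⊥-elim (¬Neutral-lam n)
  ; (ξ-appˡ s) → sn-neutral-app (Neutral-⟶β n s) (rt s) (acc ru)
  ; (ξ-appʳ s) → sn-neutral-app n (acc rt) (ru s) }

Neutral-apps-con : ∀ {k} vs → Neutral (apps (con k) vs)
Neutral-apps-con []       = con
Neutral-apps-con (v ∷ vs) = Neutral-apps-con vs · v

sn-apps-con : ∀ {k} vs → All SN vs → SN (apps (con k) vs)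
sn-apps-con []       []         = acc λ ()
sn-apps-con (v ∷ vs) (sn ∷ sns) = sn-neutral-app (Neutral-apps-con vs) (sn-apps-con vs sns) sn

data HeadRedexReduct (t u : PTerm) (vs : List PTerm) : PTerm → Set where
  contract : HeadRedexReduct t u vs (apps (t [ u ≔0]) vs)
  in-body  : ∀ {t'} → t ⟶β t' → HeadRedexReduct t u vs (apps (lam t' · u) vs)
  in-arg   : ∀ {u'} → u ⟶β u' → HeadRedexReduct t u vs (apps (lam t · u') vs)
  in-spine : ∀ {vs'} → vs ⟶βₗ vs' → HeadRedexReduct t u vs (apps (lam t · u) vs')

HeadRedexReduct-· : ∀ {t u vs w v} → HeadRedexReduct t u vs w → HeadRedexReduct t u (v ∷ vs) (w · v)
HeadRedexReduct-· contract     = contract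
HeadRedexReduct-· (in-body s)  = in-body s
HeadRedexReduct-· (in-arg s)   = in-arg s
HeadRedexReduct-· (in-spine s) = in-spine (there s)

-- The spine is split into [] and x ∷ vs so that Agda sees that apps (lam t · u) (x ∷ vs)
-- is not a λ and hence not the function part of a β-redex.
head-redex-reduct : ∀ {t u w} vs → apps (lam t · u) vs ⟶β w → HeadRedexReduct t u vs w
head-redex-reduct []           β                  = contract
head-redex-reduct []           (ξ-appˡ (ξ-lam s)) = in-body s
head-redex-reduct []           (ξ-appʳ s)         = in-arg s
head-redex-reduct (v ∷ [])     (ξ-appˡ s)         = HeadRedexReduct-· (head-redex-reduct [] s)
head-redex-reduct (v ∷ [])     (ξ-appʳ s)         = in-spine (here s)
head-redex-reduct (v ∷ x ∷ vs) (ξ-appˡ s)         = HeadRedexReduct-· (head-redex-reduct (x ∷ vs) s)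
head-redex-reduct (v ∷ x ∷ vs) (ξ-appʳ s)         = in-spine (here s)

single-⟶β* : ∀ {u u'} → u ⟶β u' → ∀ i → single u i ⟶β* single u' i
single-⟶β* s zero    = s ◅ ε
single-⟶β* s (suc i) = ε

-- By simultaneous induction on SN u and SN (apps (t [ u ≔0]) vs).
sn-head-expansion : ∀ {t u} vs → SN u → SN (apps (t [ u ≔0]) vs) → SN (apps (lam t · u) vs)
sn-head-redex-reduct : ∀ {t u w} vs → SN u → SN (apps (t [ u ≔0]) vs) → HeadRedexReduct t u vs w → SN w

sn-head-expansion vs sn-u sn-r = acc λ s → sn-head-redex-reduct vs sn-u sn-r (head-redex-reduct vs s)

sn-head-redex-reduct vs sn-u sn-r contract = sn-r
sn-head-redex-reduct {u = u} vs sn-u (acc r) (in-body s) =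
  sn-head-expansion vs sn-u (r (apps-⟶β vs (subst-⟶β (single u) s)))
sn-head-redex-reduct {t = t} vs (acc r) sn-r (in-arg s) =
  sn-head-expansion vs (r s) (sn-⟶β* (apps-⟶β* vs (subst-⟶β* (single-⟶β* s) t)) sn-r)
sn-head-redex-reduct vs sn-u (acc r) (in-spine s) =
  sn-head-expansion _ sn-u (r (apps-⟶βₗ s))

sn-lams-apps : ∀ n σ B vs → length vs ≡ n → All SN vs → SN (subst (vs ++ₛ σ) B) →
               SN (apps (subst σ (lams n B)) vs)
sn-lams-apps zero    σ B []      refl []  sn = sn
sn-lams-apps (suc n) σ B vs      len  sns sn with initLast vs
sn-lams-apps (suc n) σ B .[]         ()  _   _  | []
sn-lams-apps (suc n) σ B .(xs ∷ʳ a) len sns sn | xs ∷ʳ′ a with ∷ʳ⁻ sns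
... | sns-xs , sn-a =
  transport SN (sym (apps-∷ʳ _ xs a)) (sn-head-expansion xs sn-a sn-contractum)
  where
  length-xs : length xs ≡ n
  length-xs = suc-injective (trans (length-++-comm [ a ] xs) len)

  sn-contractum : SN (apps (subst (exts σ) (lams n B) [ a ≔0]) xs)
  sn-contractum = transport (λ z → SN (apps z xs)) (sym (subst-exts-[≔0] σ a (lams n B)))
    (sn-lams-apps n (a ∷ₛ σ) B xs length-xs sns-xs (transport SN (subst-cong (++ₛ-++ xs [ a ] σ) B) sn))

appsDesc-suc : ∀ t b j → appsDesc t b (suc j) ≡ appsDesc t (suc b) j · var b
appsDesc-suc t b zero    = cong (λ i → t · var i) (+-identityʳ b)
appsDesc-suc t b (suc j) = trans (appsDesc-suc (t · var (b + suc j)) b j)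
  (cong (λ i → appsDesc (t · var i) (suc b) j · var b) (+-suc b j))

-- Enumerates τ b xs: τ (b + i) is the i-th element of xs.
data Enumerates (τ : ℕ → PTerm) : ℕ → List PTerm → Set where
  []  : ∀ {b} → Enumerates τ b []
  _∷_ : ∀ {b x xs} → τ b ≡ x → Enumerates τ (suc b) xs → Enumerates τ b (x ∷ xs)

Enumerates-∷ₛ : ∀ {τ b xs} y → Enumerates τ b xs → Enumerates (y ∷ₛ τ) (suc b) xs
Enumerates-∷ₛ y []       = []
Enumerates-∷ₛ y (e ∷ es) = e ∷ Enumerates-∷ₛ y es

Enumerates-++ₛ : ∀ ys xs σ → Enumerates (ys ++ₛ xs ++ₛ σ) (length ys) xs
Enumerates-++ₛ []       []       σ = []
Enumerates-++ₛ []       (x ∷ xs) σ = refl ∷ Enumerates-∷ₛ x (Enumerates-++ₛ [] xs σ)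
Enumerates-++ₛ (y ∷ ys) xs       σ = Enumerates-∷ₛ y (Enumerates-++ₛ ys xs σ)

subst-appsDesc : ∀ {τ b} t xs → Enumerates τ b xs → subst τ (appsDesc t b (length xs)) ≡ apps (subst τ t) xs
subst-appsDesc         t []       []       = refl
subst-appsDesc {τ} {b} t (x ∷ xs) (e ∷ es) =
  trans (cong (subst τ) (appsDesc-suc t b (length xs))) (cong₂ _·_ (subst-appsDesc t xs es) e)

++ₛ-SN : ∀ {σ} vs → All SN vs → (∀ i → SN (σ i)) → ∀ i → SN ((vs ++ₛ σ) i)
++ₛ-SN []       []         sn-σ i       = sn-σ i
++ₛ-SN (v ∷ vs) (sn ∷ sns) sn-σ zero    = sn
++ₛ-SN (v ∷ vs) (sn ∷ sns) sn-σ (suc i) = ++ₛ-SN vs sns sn-σ i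

Reducible : ℕ → PTerm → Set
Reducible n e = ∀ σ → (∀ i → SN (σ i)) → ∀ vs → length vs ≡ n → All SN vs → SN (apps (subst σ e) vs)

reducible-con : ∀ n k → Reducible n (con k)
reducible-con n k σ sn-σ vs _ sns = sn-apps-con vs sns

reducible⇒SN : ∀ n e → Reducible n e → SN e
reducible⇒SN n e r = transport SN (subst-var e)
  (sn-appsˡ vs (r var (λ _ → sn-var) vs (length-replicate n) (replicate⁺ n sn-var)))
  where
  vs = replicate n (var 0)

cutBody : ℕ → ℕ → PTerm → PTerm → PTerm
cutBody m k e₁ e₂ = appsDesc (shift (m + k) e₂) 0 k · appsDesc (shift (m + k) e₁) k m

cutTerm : ℕ → ℕ → PTerm → PTerm → PTerm
cutTerm m k e₁ e₂ = lams m (lams k (cutBody m k e₁ e₂))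

lams-+ : ∀ m k B → lams m (lams k B) ≡ lams (m + k) B
lams-+ zero    k B = refl
lams-+ (suc m) k B = cong lam (lams-+ m k B)

split-at-length : ∀ {A : Set} k m (vs : List A) → length vs ≡ k + m →
                  ∃₂ λ bs as → vs ≡ bs ++ as × length bs ≡ k × length as ≡ m
split-at-length zero    m vs       len = [] , vs , refl , refl , len
split-at-length (suc k) m (v ∷ vs) len with split-at-length k m vs (suc-injective len)
... | bs , as , refl , refl , len-as = v ∷ bs , as , refl , refl , len-as

-- The body of the cut term, with the argument substitution bs ++ₛ as ++ₛ σ, is
-- e₂ applied to bs and to e₁ applied to as (under the substitution σ shifted past them).
sn-cut-body : ∀ {σ e₁ e₂} bs as → (∀ i → SN (σ i)) → All SN bs → All SN as →
              Reducible (length as) e₁ → Reducible (suc (length bs)) e₂ →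
              SN (subst (bs ++ₛ as ++ₛ σ) (cutBody (length as) (length bs) e₁ e₂))
sn-cut-body {σ} {e₁} {e₂} bs as sn-σ sn-bs sn-as r₁ r₂ =
  transport SN (sym (cong₂ _·_ (subst-shift-appsDesc e₂ bs (Enumerates-++ₛ [] bs (as ++ₛ σ)))
                               (subst-shift-appsDesc e₁ as (Enumerates-++ₛ bs as σ))))
    (r₂ ρ sn-ρ (apps (subst ρ e₁) as ∷ bs) refl (r₁ ρ sn-ρ as refl sn-as ∷ sn-bs))
  where
  N = length as + length bs
  τ = bs ++ₛ as ++ₛ σ
  ρ = τ ∘ (N +_)

  sn-ρ : ∀ i → SN (ρ i)
  sn-ρ i = ++ₛ-SN bs sn-bs (++ₛ-SN as sn-as sn-σ) (N + i)

  subst-shift-appsDesc : ∀ {b} e xs → Enumerates τ b xs → subst τ (appsDesc (shift N e) b (length xs)) ≡ apps (subst ρ e) xs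
  subst-shift-appsDesc e xs en = trans (subst-appsDesc _ xs en) (cong (λ z → apps z xs) (subst-rename τ (N +_) e))

reducible-cut : ∀ m k e₁ e₂ → Reducible m e₁ → Reducible (suc k) e₂ → Reducible (m + k) (cutTerm m k e₁ e₂)
reducible-cut m k e₁ e₂ r₁ r₂ σ sn-σ vs len sns =
  transport (λ z → SN (apps (subst σ z) vs)) (sym (lams-+ m k _)) (sn-lams-apps (m + k) σ _ vs len sns sn-body)
  where
  sn-body : SN (subst (vs ++ₛ σ) (cutBody m k e₁ e₂))
  sn-body with split-at-length k m vs (trans len (+-comm m k))
  ... | bs , as , refl , refl , refl with ++⁻ bs sns
  ... | sn-bs , sn-as = transport SN (sym (subst-cong (++ₛ-++ bs as σ) (cutBody (length as) (length bs) e₁ e₂))) (sn-cut-body {e₁ = e₁} {e₂} bs as sn-σ sn-bs sn-as r₁ r₂)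

module Typing (Fun : Set) (farity : Fun → ℕ) (Pred : Set) (parity : Pred → ℕ) where
  open Logic Fun farity Pred parity

  arity : Formula → ℕ
  arity (plain H) = length (Horn.body H)
  arity (all H)   = length (Horn.body H)

  ⊢⇒reducible : ∀ {Φ e F} → Φ ⊢ e ∶ F → Reducible (arity F) e
  ⊢⇒reducible (axiom {κ} _) = reducible-con _ κ
  ⊢⇒reducible (gen d)       = ⊢⇒reducible d
  ⊢⇒reducible (inst {e = e} {H = As ⇒ _} σ d) =
    transport (λ n → Reducible n e) (sym (length-map (substA σ) As)) (⊢⇒reducible d)
  ⊢⇒reducible (cut {e₁ = e₁} {e₂} {As} {Bs} {D} d₁ d₂) =
    transport (λ n → Reducible n (cutTerm (length As) (length Bs) e₁ e₂)) (sym (length-++ As))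
      (reducible-cut (length As) (length Bs) e₁ e₂ (⊢⇒reducible d₁)
        (transport (λ n → Reducible n e₂) (length-++-comm Bs [ D ]) (⊢⇒reducible d₂)))

theorem2 : (Fun : Set) (farity : Fun → ℕ) (Pred : Set) (parity : Pred → ℕ) →
    let open Logic Fun farity Pred parity in
    (Φ : Program) → Unique (map proj₁ Φ) →
    (e : PTerm) (F : Formula) → Φ ⊢ e ∶ F → SN e
theorem2 Fun farity Pred parity Φ _ e F d =
  reducible⇒SN _ e (Typing.⊢⇒reducible Fun farity Pred parity d)
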